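{- For every integer $k\geq1$, every real number $\alpha\geq1$, every graph $G$ with $|V(G)|>\alpha+k+1$ and treewidth $k$, and every normal tree-decomposition $(B_x:x\in V(T))$ of $G$ of width $k$, there exist a vertex $z\in V(T)$ and a set $\mathcal{C}$ of $z$-subtrees of $T$ such that $$\alpha<\sum_{T'\in\mathcal{C}}|G(T',z)|\leq2\alpha.$$
   Context: A tree-decomposition of $G$ is a family of bags $(B_x\subseteq V(G): x\in V(T))$ indexed by the vertices of a tree $T$ such that for each $v\in V(G)$ the set $\{x: v\in B_x\}$ induces a nonempty subtree of $T$, and each edge of $G$ has both ends in some bag; its width is $\max_x|B_x|-1$. A tree-decomposition of width $k$ is normal if every bag has size exactly $k+1$ and the intersection of any two bags indexed by adjacent vertices of $T$ has size exactly $k$. For $z\in V(T)$, a $z$-subtree of $T$ is a maximal subtree of $T$ in which $z$ appears only as a leaf (a vertex of degree 1 in that subtree). For a subtree $T'$ of $T$ and $z\in V(T)$, $G(T',z):=\big(\bigcup_{x\in V(T')}B_x\big)\setminus B_z$.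
   Formalization: The parameter α ranges over the rationals at least 1 rather than over the real numbers at least 1. -}

module Defs where

open import Data.Nat as ℕ using (ℕ; zero; suc; _≤_)
open import Data.Integer using (+_)
open import Data.Rational as ℚ using (ℚ; _/_)
open import Data.Bool using (Bool; true; false; _∧_; _∨_)
open import Data.Fin using (Fin; zero; suc; inject₁; fromℕ)
open import Data.Fin.Subset using (Subset; _∈_; _∉_; _⊆_; _∩_; _─_; ∣_∣)
open import Data.Vec using (Vec; tabulate; lookup)
open import Data.List using (List; map)
open import Data.Nat.ListAction using (sum)
open import Data.Product using (Σ; ∃; _×_; _,_)
open import Function.Definitions using (Injective)
open import Relation.Binary.PropositionalEquality using (_≡_)
open import Relation.Nullary using (¬_)

toℚ : ℕ → ℚ
toℚ n = (+ n) / 1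

record Graph : Set where
  field
    n     : ℕ
    adj   : Fin n → Fin n → Bool
    sym   : ∀ u v → adj u v ≡ adj v u
    irrfl : ∀ u → adj u u ≡ false
open Graph public

data WalkIn (G : Graph) (S : Subset (n G)) : Fin (n G) → Fin (n G) → Set where
  here : ∀ {u} → u ∈ S → WalkIn G S u u
  step : ∀ {u w v} → u ∈ S → adj G u w ≡ true → WalkIn G S w v → WalkIn G S u v

ConnectedIn : (G : Graph) → Subset (n G) → Set
ConnectedIn G S = ∀ u v → u ∈ S → v ∈ S → WalkIn G S u v

-- a cycle of length l+3 : distinct vertices, consecutive ones adjacent, closing up
IsCycle : (G : Graph) (l : ℕ) → (Fin (suc (suc (suc l))) → Fin (n G)) → Set
IsCycle G l c =
  Injective _≡_ _≡_ c
  × (∀ (i : Fin (suc (suc l))) → adj G (c (inject₁ i)) (c (suc i)) ≡ true)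
  × adj G (c (fromℕ (suc (suc l)))) (c zero) ≡ true

Acyclic : Graph → Set
Acyclic G = ∀ l c → ¬ IsCycle G l c

IsTree : Graph → Set
IsTree T = (1 ≤ n T) × ConnectedIn T (tabulate (λ _ → true)) × Acyclic T

-- subtrees of a tree T, identified with their (nonempty, connected) vertex sets
IsSubtree : (T : Graph) → Subset (n T) → Set
IsSubtree T S = (∃ λ x → x ∈ S) × ConnectedIn T S

record TreeDecomposition (G : Graph) : Set₁ where
  field
    T       : Graph
    T-tree  : IsTree T
    B       : Fin (n T) → Subset (n G)
    vertex-subtree : ∀ (v : Fin (n G)) → IsSubtree T (tabulate (λ x → lookup (B x) v))
    edge-covered   : ∀ u v → adj G u v ≡ true → ∃ λ x → u ∈ B x × v ∈ B x
open TreeDecomposition public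

WidthAtMost : ∀ {G} → TreeDecomposition G → ℕ → Set
WidthAtMost D k = ∀ x → ∣ B D x ∣ ≤ suc k

HasWidth : ∀ {G} → TreeDecomposition G → ℕ → Set
HasWidth D k = WidthAtMost D k × ∃ λ x → ∣ B D x ∣ ≡ suc k

HasTreewidth : Graph → ℕ → Set₁
HasTreewidth G k =
  (Σ (TreeDecomposition G) λ D → HasWidth D k)
  × (∀ (D : TreeDecomposition G) (j : ℕ) → HasWidth D j → k ≤ j)

IsNormal : ∀ {G} → TreeDecomposition G → ℕ → Set
IsNormal D k =
  (∀ x → ∣ B D x ∣ ≡ suc k)
  × (∀ x y → adj (T D) x y ≡ true → ∣ B D x ∩ B D y ∣ ≡ k)

degIn : (T : Graph) → Subset (n T) → Fin (n T) → ℕ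
degIn T S z = ∣ tabulate (adj T z) ∩ S ∣

-- S is a subtree of T in which z appears (only) as a leaf
ZLeafSubtree : (T : Graph) → Fin (n T) → Subset (n T) → Set
ZLeafSubtree T z S = IsSubtree T S × z ∈ S × degIn T S z ≡ 1

IsZSubtree : (T : Graph) → Fin (n T) → Subset (n T) → Set
IsZSubtree T z S =
  ZLeafSubtree T z S × (∀ S′ → ZLeafSubtree T z S′ → S ⊆ S′ → S′ ⊆ S)

anyFin : ∀ {m} → (Fin m → Bool) → Bool
anyFin {zero}  f = false
anyFin {suc m} f = f zero ∨ anyFin (λ i → f (suc i))

bagUnion : ∀ {G} (D : TreeDecomposition G) → Subset (n (T D)) → Subset (n G)
bagUnion D S = tabulate (λ v → anyFin (λ x → lookup S x ∧ lookup (B D x) v))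

G⟨_,_⟩ : ∀ {G} (D : TreeDecomposition G) → Subset (n (T D)) → Fin (n (T D)) → Subset (n G)
G⟨ D , S ⟩ z = bagUnion D S ─ B D z

{-# OPTIONS --safe #-}
-- Weigh a z-subtree T′ by |G(T′,z)|. The z-subtrees through the neighbours of z cover
-- V(G) ∖ B_z, so at the start their total weight is at least |V(G)| − (k+1) > α. If none of
-- them weighs more than 2α, then either one lies in (α, 2α], or all weigh at most α and the
-- shortest suffix of total weight > α lies in (α, 2α]. Otherwise move to the neighbour y
-- spanning a heavy z-subtree T′: by normality B_y ∖ B_z is a single vertex, so the
-- y-subtrees pointing away from z weigh at least |G(T′,z)| − 1 > 2α − 1 ≥ α in total, and
-- the heavy subtree strictly shrinks, so the descent terminates.
module Submission where

open import Defs renaming (sym to adj-sym)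
open import Data.Nat as ℕ using (ℕ; zero; suc; _∸_; z≤n; s≤s) renaming (_≤_ to _≤ℕ_; _<_ to _<ℕ_)
import Data.Nat.Properties as ℕ
open import Data.Nat.Induction using (<-wellFounded)
open import Data.Nat.ListAction using (sum)
open import Data.Integer as ℤ using (+_)
import Data.Integer.Properties as ℤ
open import Data.Nat.Coprimality as Coprime using (1-coprimeTo)
open import Data.Rational using (ℚ; mkℚ; _/_; _<_; _≤_; _+_; _*_; 0ℚ; 1ℚ; *≤*; _<?_; _≤?_)
open import Data.Rational.Properties
  using (normalize-coprime; ≤-trans; <-≤-trans; <-irrefl; ≰⇒>; ≮⇒≥; +-mono-≤; +-monoʳ-≤; +-assoc; +-comm;
         *-distribʳ-+; *-identityˡ; module ≤-Reasoning)
open import Data.Bool using (Bool; true; false; _∧_)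
import Data.Bool.Properties as Bool
open import Data.Fin using (Fin; zero; suc; inject₁; fromℕ; fromℕ<; _≟_)
import Data.Fin.Properties as Fin
open import Data.Fin.Subset
  using (Subset; inside; outside; _∈_; _∉_; _⊆_; _∩_; _∪_; _─_; _-_; ∁; ⁅_⁆; ⊤; ∣_∣)
open import Data.Fin.Subset.Properties
  using (_∈?_; ∈⊤; x∈⁅x⁆; x∈⁅y⁆⇒x≡y; x∉⁅y⁆⇒x≢y; x∈p∩q⁺; x∈p∩q⁻; x∈p∪q⁺; x∈p∪q⁻; x∈p∧x≢y⇒x∈p-y;
         p─q⊆p; x∈p∧x∉q⇒x∈p─q; x∈p⇒∣p-x∣<∣p∣; p⊆q⇒∣p∣≤∣q∣; p⊂q⇒∣p∣<∣q∣; ⊆-antisym; ∣⁅x⁆∣≡1;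
         ∣p∩q∣≤∣q∣; ∣∁p∣≡n∸∣p∣; ∣⊥∣≡0; Empty-unique; x∈∁p⇒x∉p)
open import Data.Vec using (tabulate; lookup; _∷_; []; here; there)
open import Data.Vec.Properties using ([]=⇒lookup; lookup⇒[]=; lookup∘tabulate)
open import Data.List using (List; []; _∷_; [_]; map; filter; allFin)
open import Data.List.Relation.Unary.All as All using (All; []; _∷_)
import Data.List.Relation.Unary.All.Properties as All
open import Data.List.Relation.Unary.Any as Any using (Any; any?)
import Data.List.Relation.Unary.Any.Properties as Any
open import Data.List.Relation.Unary.AllPairs using ([]; _∷_)
open import Data.List.Relation.Unary.Unique.Propositional using (Unique)
import Data.List.Relation.Unary.Unique.Propositional.Properties as Unique
open import Data.List.Membership.Propositional using (find; lose) renaming (_∈_ to _∈ˡ_)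
open import Data.List.Membership.Propositional.Properties using (∈-filter⁻; ∈-filter⁺; ∈-allFin)
import Data.List.Relation.Binary.Sublist.Propositional as Sublist
open Sublist using ([]; _∷_; _∷ʳ_; ⊆-refl; from∈)
open import Data.List.Relation.Binary.Sublist.Propositional.Properties using (All-resp-⊆)
open import Data.Product using (Σ; ∃; _×_; _,_; proj₁; proj₂)
open import Data.Sum as Sum using (_⊎_; inj₁; inj₂)
open import Data.Empty using (⊥-elim)
open import Function using (_∘_)
open import Function.Definitions using (Injective)
open import Induction.WellFounded using (Acc; acc)
open import Relation.Nullary using (¬_; Dec; yes; no; does; ¬?; contradiction)
open import Relation.Nullary.Decidable using (map′; dec-true; _×-dec_)
open import Relation.Binary.PropositionalEquality
  using (_≡_; _≢_; refl; sym; trans; cong; cong₂; subst; module ≡-Reasoning)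

toℚ≡mkℚ : ∀ n → toℚ n ≡ mkℚ (+ n) 0 (Coprime.sym (1-coprimeTo n))
toℚ≡mkℚ n = normalize-coprime (Coprime.sym (1-coprimeTo n))

toℚ-homo-+ : ∀ m n → toℚ (m ℕ.+ n) ≡ toℚ m + toℚ n
toℚ-homo-+ m n rewrite toℚ≡mkℚ m | toℚ≡mkℚ n =
  cong (_/ 1) (sym (cong₂ ℤ._+_ (ℤ.*-identityʳ (+ m)) (ℤ.*-identityʳ (+ n))))

toℚ-mono-≤ : ∀ {m n} → m ≤ℕ n → toℚ m ≤ toℚ n
toℚ-mono-≤ {m} {n} m≤n rewrite toℚ≡mkℚ m | toℚ≡mkℚ n = *≤* (ℤ.*-monoʳ-≤-nonNeg (+ 1) (ℤ.+≤+ m≤n))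

2*p≡p+p : ∀ p → toℚ 2 * p ≡ p + p
2*p≡p+p p = trans (*-distribʳ-+ p 1ℚ 1ℚ) (cong₂ _+_ (*-identityˡ p) (*-identityˡ p))

<⇒≱ : ∀ {p q} → p < q → ¬ q ≤ p
<⇒≱ p<q q≤p = <-irrefl refl (<-≤-trans p<q q≤p)

p+m<n⇒p<n∸m : ∀ {p} m n → p + toℚ m < toℚ n → p < toℚ (n ∸ m)
p+m<n⇒p<n∸m {p} m n p+m<n = ≰⇒> λ n∸m≤p → <⇒≱ p+m<n (begin
  toℚ n               ≤⟨ toℚ-mono-≤ (ℕ.m≤n+m∸n n m) ⟩
  toℚ (m ℕ.+ (n ∸ m)) ≡⟨ toℚ-homo-+ m (n ∸ m) ⟩
  toℚ m + toℚ (n ∸ m) ≤⟨ +-monoʳ-≤ (toℚ m) n∸m≤p ⟩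
  toℚ m + p           ≡⟨ +-comm (toℚ m) p ⟩
  p + toℚ m           ∎)
  where open ≤-Reasoning

p+p<1+n⇒p<n : ∀ {p} n → 1ℚ ≤ p → p + p < toℚ (suc n) → p < toℚ n
p+p<1+n⇒p<n {p} n 1≤p p+p<1+n = ≰⇒> λ n≤p → <⇒≱ p+p<1+n (begin
  toℚ (suc n) ≡⟨ toℚ-homo-+ 1 n ⟩
  1ℚ + toℚ n  ≤⟨ +-mono-≤ 1≤p n≤p ⟩
  p + p       ∎)
  where open ≤-Reasoning

Unique-resp-⊆ : ∀ {A : Set} {xs ys : List A} → ys Sublist.⊆ xs → Unique xs → Unique ys
Unique-resp-⊆ []             []         = []
Unique-resp-⊆ (_ ∷ʳ ys⊆xs)   (_ ∷ u)    = Unique-resp-⊆ ys⊆xs u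
Unique-resp-⊆ (refl ∷ ys⊆xs) (x∉xs ∷ u) = All-resp-⊆ ys⊆xs x∉xs ∷ Unique-resp-⊆ ys⊆xs u

Unique-map⁺-injectiveOn : ∀ {A B : Set} {f : A → B} {xs : List A} →
  (∀ {x y} → x ∈ˡ xs → y ∈ˡ xs → f x ≡ f y → x ≡ y) → Unique xs → Unique (map f xs)
Unique-map⁺-injectiveOn _ [] = []
Unique-map⁺-injectiveOn injective (x∉xs ∷ u) =
  All.map⁺ (All.tabulate λ y∈xs fx≡fy →
    All.lookup x∉xs y∈xs (injective (Any.here refl) (Any.there y∈xs) fx≡fy))
  ∷ Unique-map⁺-injectiveOn (λ x∈ y∈ → injective (Any.there x∈) (Any.there y∈)) u

InWindow : ℚ → ℕ → Set
InWindow α m = α < toℚ m × toℚ m ≤ α + α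

module _ {A : Set} (f : A → ℕ) {α : ℚ} where

  -- The shortest suffix whose sum exceeds α: without its head it sums to at most α.
  suffix-crossing : ∀ {β} xs → 0ℚ ≤ α → All (λ a → toℚ (f a) ≤ β) xs → α < toℚ (sum (map f xs)) →
    ∃ λ ys → ys Sublist.⊆ xs × α < toℚ (sum (map f ys)) × toℚ (sum (map f ys)) ≤ β + α
  suffix-crossing []       0≤α []             α<0 = contradiction 0≤α (<⇒≱ α<0)
  suffix-crossing {β} (x ∷ xs) 0≤α (fx≤β ∷ fxs≤β) α<Σ = crossing-in-xs? (α <? toℚ (sum (map f xs)))
    where
    crossing-in-xs? : Dec (α < toℚ (sum (map f xs))) →
      ∃ λ ys → ys Sublist.⊆ x ∷ xs × α < toℚ (sum (map f ys)) × toℚ (sum (map f ys)) ≤ β + α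
    crossing-in-xs? (yes α<Σxs) =
      let ys , ys⊆xs , crosses = suffix-crossing xs 0≤α fxs≤β α<Σxs in ys , x ∷ʳ ys⊆xs , crosses
    crossing-in-xs? (no α≮Σxs) = x ∷ xs , ⊆-refl , α<Σ , (begin
      toℚ (f x ℕ.+ sum (map f xs))     ≡⟨ toℚ-homo-+ (f x) _ ⟩
      toℚ (f x) + toℚ (sum (map f xs)) ≤⟨ +-mono-≤ fx≤β (≮⇒≥ α≮Σxs) ⟩
      β + α                            ∎)
      where open ≤-Reasoning

  HeavyOrWindow : List A → Set
  HeavyOrWindow xs =
    Any (λ a → α + α < toℚ (f a)) xs ⊎ ∃ λ ys → ys Sublist.⊆ xs × InWindow α (sum (map f ys))

  heavy-or-window : ∀ xs → 0ℚ ≤ α → α < toℚ (sum (map f xs)) → HeavyOrWindow xs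
  heavy-or-window xs 0≤α α<Σ = some-above-α? (any? (λ a → α <? toℚ (f a)) xs)
    where
    above-2α? : ∀ {a} → a ∈ˡ xs → α < toℚ (f a) → Dec (toℚ (f a) ≤ α + α) → HeavyOrWindow xs
    above-2α? a∈xs α<fa (no fa≰2α)  = inj₁ (lose a∈xs (≰⇒> fa≰2α))
    above-2α? {a} a∈xs α<fa (yes fa≤2α) =
      inj₂ ([ a ] , from∈ a∈xs , subst (InWindow α) (sym (ℕ.+-identityʳ (f a))) (α<fa , fa≤2α))

    some-above-α? : Dec (Any (λ a → α < toℚ (f a)) xs) → HeavyOrWindow xs
    some-above-α? (yes some) =
      let a , a∈xs , α<fa = find some in above-2α? a∈xs α<fa (toℚ (f a) ≤? α + α)
    some-above-α? (no none)  = inj₂ (suffix-crossing xs 0≤α (All.map ≮⇒≥ (All.¬Any⇒All¬ xs none)) α<Σ)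

x∈p─q⇒x∉q : ∀ {n} {x : Fin n} (p q : Subset n) → x ∈ p ─ q → x ∉ q
x∈p─q⇒x∉q (inside ∷ p) (outside ∷ q) here ()
x∈p─q⇒x∉q (_ ∷ p) (_ ∷ q) (there x∈p─q) (there x∈q) = x∈p─q⇒x∉q p q x∈p─q x∈q

∣p∣≡∣p∩q∣+∣p─q∣ : ∀ {n} (p q : Subset n) → ∣ p ∣ ≡ ∣ p ∩ q ∣ ℕ.+ ∣ p ─ q ∣
∣p∣≡∣p∩q∣+∣p─q∣ []            []            = refl
∣p∣≡∣p∩q∣+∣p─q∣ (inside ∷ p)  (inside ∷ q)  = cong suc (∣p∣≡∣p∩q∣+∣p─q∣ p q)
∣p∣≡∣p∩q∣+∣p─q∣ (inside ∷ p)  (outside ∷ q) =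
  trans (cong suc (∣p∣≡∣p∩q∣+∣p─q∣ p q)) (sym (ℕ.+-suc _ _))
∣p∣≡∣p∩q∣+∣p─q∣ (outside ∷ p) (inside ∷ q)  = ∣p∣≡∣p∩q∣+∣p─q∣ p q
∣p∣≡∣p∩q∣+∣p─q∣ (outside ∷ p) (outside ∷ q) = ∣p∣≡∣p∩q∣+∣p─q∣ p q

module _ {n : ℕ} where

  x∈tabulate⁺ : ∀ {f : Fin n → Bool} {x} → f x ≡ true → x ∈ tabulate f
  x∈tabulate⁺ {f} {x} fx≡true = lookup⇒[]= x (tabulate f) (trans (lookup∘tabulate f x) fx≡true)

  x∈tabulate⁻ : ∀ {f : Fin n → Bool} {x} → x ∈ tabulate f → f x ≡ true
  x∈tabulate⁻ {f} {x} x∈ = trans (sym (lookup∘tabulate f x)) ([]=⇒lookup x∈)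

  x∈p-y⇒x≢y : ∀ {x y : Fin n} {p} → x ∈ p - y → x ≢ y
  x∈p-y⇒x≢y {y = y} {p} x∈p-y = x∉⁅y⁆⇒x≢y (x∈p─q⇒x∉q p ⁅ y ⁆ x∈p-y)

  x≢y⇒x∈⊤-y : ∀ {x y : Fin n} → x ≢ y → x ∈ ⊤ - y
  x≢y⇒x∈⊤-y = x∈p∧x≢y⇒x∈p-y ∈⊤

  p-x⊆⊤-x : ∀ {p} {x : Fin n} → p - x ⊆ ⊤ - x
  p-x⊆⊤-x = x≢y⇒x∈⊤-y ∘ x∈p-y⇒x≢y

  1≤∣p∣ : ∀ {x : Fin n} {p} → x ∈ p → 1 ≤ℕ ∣ p ∣
  1≤∣p∣ x∈p = ℕ.≤-trans (s≤s z≤n) (x∈p⇒∣p-x∣<∣p∣ x∈p)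

  x≢y⇒2≤∣p∣ : ∀ {x y : Fin n} {p} → x ∈ p → y ∈ p → x ≢ y → 2 ≤ℕ ∣ p ∣
  x≢y⇒2≤∣p∣ x∈p y∈p x≢y =
    ℕ.≤-trans (s≤s (1≤∣p∣ (x∈p∧x≢y⇒x∈p-y y∈p (x≢y ∘ sym)))) (x∈p⇒∣p-x∣<∣p∣ x∈p)

  only-x∈p⇒∣p∣≡1 : ∀ {x : Fin n} {p} → x ∈ p → (∀ {y} → y ∈ p → y ≡ x) → ∣ p ∣ ≡ 1
  only-x∈p⇒∣p∣≡1 {x} {p} x∈p only-x = trans (cong ∣_∣ p≡⁅x⁆) (∣⁅x⁆∣≡1 x)
    where
    p≡⁅x⁆ : p ≡ ⁅ x ⁆
    p≡⁅x⁆ = ⊆-antisym (λ y∈p → subst (_∈ ⁅ x ⁆) (sym (only-x y∈p)) (x∈⁅x⁆ x))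
                      (λ y∈⁅x⁆ → subst (_∈ p) (sym (x∈⁅y⁆⇒x≡y x y∈⁅x⁆)) x∈p)

  ∣p∣≤sum-over-cover : ∀ {A : Set} (f : A → Subset n) xs {p} →
    (∀ {v} → v ∈ p → Any (λ a → v ∈ f a) xs) → ∣ p ∣ ≤ℕ sum (map (λ a → ∣ f a ∣) xs)
  ∣p∣≤sum-over-cover f [] {p} covered = ℕ.≤-reflexive (trans (cong ∣_∣ p≡⊥) (∣⊥∣≡0 n))
    where p≡⊥ = Empty-unique λ (_ , v∈p) → Any.¬Any[] (covered v∈p)
  ∣p∣≤sum-over-cover f (a ∷ xs) {p} covered = begin
    ∣ p ∣                       ≡⟨ ∣p∣≡∣p∩q∣+∣p─q∣ p (f a) ⟩
    ∣ p ∩ f a ∣ ℕ.+ ∣ p ─ f a ∣ ≤⟨ ℕ.+-mono-≤ (∣p∩q∣≤∣q∣ p (f a)) (∣p∣≤sum-over-cover f xs covered-rest) ⟩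
    ∣ f a ∣ ℕ.+ _               ∎
    where
    open ℕ.≤-Reasoning
    covered-rest : ∀ {v} → v ∈ p ─ f a → Any (λ a → v ∈ f a) xs
    covered-rest v∈p─fa with covered (p─q⊆p p (f a) v∈p─fa)
    ... | Any.here v∈fa = contradiction v∈fa (x∈p─q⇒x∉q p (f a) v∈p─fa)
    ... | Any.there v∈xs = v∈xs

dec-true⁻ : ∀ {P : Set} (P? : Dec P) → does P? ≡ true → P
dec-true⁻ (yes p) _ = p

∧≡true⁻ : ∀ {a b} → a ∧ b ≡ true → a ≡ true × b ≡ true
∧≡true⁻ {true} {true} _ = refl , refl

anyFin⁺ : ∀ {m} (f : Fin m → Bool) i → f i ≡ true → anyFin f ≡ true
anyFin⁺ f zero    fi≡true rewrite fi≡true = refl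
anyFin⁺ f (suc i) fi≡true with f zero
... | true  = refl
... | false = anyFin⁺ (f ∘ suc) i fi≡true

anyFin⁻ : ∀ {m} (f : Fin m → Bool) → anyFin f ≡ true → ∃ λ i → f i ≡ true
anyFin⁻ {suc m} f any≡true with f zero in f0≡
... | true  = zero , f0≡
... | false = let i , fi≡true = anyFin⁻ (f ∘ suc) any≡true in suc i , fi≡true

module _ {G : Graph} (D : TreeDecomposition G) where

  ∈-bagUnion⁺ : ∀ {S x v} → x ∈ S → v ∈ B D x → v ∈ bagUnion D S
  ∈-bagUnion⁺ {S} {x} {v} x∈S v∈Bx =
    x∈tabulate⁺ (anyFin⁺ (λ y → lookup S y ∧ lookup (B D y) v) x
                         (cong₂ _∧_ ([]=⇒lookup x∈S) ([]=⇒lookup v∈Bx)))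

  ∈-bagUnion⁻ : ∀ {S v} → v ∈ bagUnion D S → ∃ λ x → x ∈ S × v ∈ B D x
  ∈-bagUnion⁻ {S} {v} v∈⋃ with anyFin⁻ (λ y → lookup S y ∧ lookup (B D y) v) (x∈tabulate⁻ v∈⋃)
  ... | x , x∈S∧v∈Bx =
    let x∈S , v∈Bx = ∧≡true⁻ x∈S∧v∈Bx in x , lookup⇒[]= x S x∈S , lookup⇒[]= v (B D x) v∈Bx

  ∈-G⟨⟩⁺ : ∀ {S x z v} → x ∈ S → v ∈ B D x → v ∉ B D z → v ∈ G⟨ D , S ⟩ z
  ∈-G⟨⟩⁺ x∈S v∈Bx v∉Bz = x∈p∧x∉q⇒x∈p─q (∈-bagUnion⁺ x∈S v∈Bx) v∉Bz

  ∈-G⟨⟩⁻ : ∀ {S z v} → v ∈ G⟨ D , S ⟩ z → (∃ λ x → x ∈ S × v ∈ B D x) × v ∉ B D z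
  ∈-G⟨⟩⁻ {S} {z} v∈G = ∈-bagUnion⁻ (p─q⊆p _ _ v∈G) , x∈p─q⇒x∉q (bagUnion D S) (B D z) v∈G

ExitWalk : (Γ : Graph) → Subset (n Γ) → Fin (n Γ) → Fin (n Γ) → Set
ExitWalk Γ A u v = ∃ λ w → adj Γ u w ≡ true × WalkIn Γ (A - u) w v

adj⇒≢ : ∀ Γ {u v} → adj Γ u v ≡ true → u ≢ v
adj⇒≢ Γ {u} uv refl with trans (sym uv) (irrfl Γ u)
... | ()

module _ {Γ : Graph} where

  walk-start : ∀ {A u v} → WalkIn Γ A u v → u ∈ A
  walk-start (here u∈A)     = u∈A
  walk-start (step u∈A _ _) = u∈A

  walk-mono : ∀ {A A′} → A ⊆ A′ → ∀ {u v} → WalkIn Γ A u v → WalkIn Γ A′ u v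
  walk-mono A⊆A′ (here u∈A)     = here (A⊆A′ u∈A)
  walk-mono A⊆A′ (step u∈A uw p) = step (A⊆A′ u∈A) uw (walk-mono A⊆A′ p)

  _++ʷ_ : ∀ {A u w v} → WalkIn Γ A u w → WalkIn Γ A w v → WalkIn Γ A u v
  here _       ++ʷ q = q
  step u∈A uw p ++ʷ q = step u∈A uw (p ++ʷ q)

  walk-reverse : ∀ {A u v} → WalkIn Γ A u v → WalkIn Γ A v u
  walk-reverse (here u∈A) = here u∈A
  walk-reverse (step {u} {w} u∈A uw p) =
    walk-reverse p ++ʷ step (walk-start p) (trans (adj-sym Γ w u) uw) (here u∈A)

  walk-restrict : ∀ {A S u v} → (∀ {x} → WalkIn Γ A u x → x ∈ S) → WalkIn Γ A u v → WalkIn Γ S u v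
  walk-restrict reached (here u∈A)       = here (reached (here u∈A))
  walk-restrict reached (step u∈A uw p) =
    step (reached (here u∈A)) uw (walk-restrict (reached ∘ step u∈A uw) p)

  walk-avoids-or-reaches : ∀ {A w v} u → WalkIn Γ A w v → WalkIn Γ (A - u) w v ⊎ WalkIn Γ A w u
  walk-avoids-or-reaches {w = w} u p with w ≟ u
  ... | yes refl = inj₂ (here (walk-start p))
  walk-avoids-or-reaches u (here w∈A)     | no w≢u = inj₁ (here (x∈p∧x≢y⇒x∈p-y w∈A w≢u))
  walk-avoids-or-reaches u (step w∈A ww′ p) | no w≢u =
    Sum.map (step (x∈p∧x≢y⇒x∈p-y w∈A w≢u) ww′) (step w∈A ww′) (walk-avoids-or-reaches u p)

  walk-from-exit : ∀ {A u v} → u ∈ A → ExitWalk Γ A u v → WalkIn Γ A u v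
  walk-from-exit u∈A (_ , uw , p) = step u∈A uw (walk-mono (p─q⊆p _ _) p)

  walk-last-exit : ∀ {A w v} u → WalkIn Γ A w v → u ≡ v ⊎ WalkIn Γ (A - u) w v ⊎ ExitWalk Γ A u v
  walk-last-exit {w = w} u (here w∈A) with w ≟ u
  ... | yes refl = inj₁ refl
  ... | no w≢u   = inj₂ (inj₁ (here (x∈p∧x≢y⇒x∈p-y w∈A w≢u)))
  walk-last-exit {w = w} u (step w∈A ww′ p) with walk-last-exit u p
  ... | inj₁ u≡v         = inj₁ u≡v
  ... | inj₂ (inj₂ exit) = inj₂ (inj₂ exit)
  ... | inj₂ (inj₁ q) with w ≟ u
  ...   | yes refl = inj₂ (inj₂ (_ , ww′ , q))
  ...   | no w≢u   = inj₂ (inj₁ (step (x∈p∧x≢y⇒x∈p-y w∈A w≢u) ww′ q))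

  walk-exit : ∀ {A u v} → WalkIn Γ A u v → u ≡ v ⊎ ExitWalk Γ A u v
  walk-exit (here _) = inj₁ refl
  walk-exit {u = u} (step _ uw p) with walk-last-exit u p
  ... | inj₁ u≡v         = inj₁ u≡v
  ... | inj₂ (inj₁ q)    = inj₂ (_ , uw , q)
  ... | inj₂ (inj₂ exit) = inj₂ exit

  walk?-acc : ∀ {A} → Acc _<ℕ_ ∣ A ∣ → ∀ u v → Dec (WalkIn Γ A u v)
  walk?-acc {A} (acc smaller) u v with u ∈? A | u ≟ v
  ... | no u∉A  | _        = no (u∉A ∘ walk-start)
  ... | yes u∈A | yes refl = yes (here u∈A)
  ... | yes u∈A | no u≢v   = map′ (walk-from-exit u∈A) (Sum.fromInj₂ (⊥-elim ∘ u≢v) ∘ walk-exit)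
    (Fin.any? λ w → (adj Γ u w Bool.≟ true) ×-dec walk?-acc (smaller (x∈p⇒∣p-x∣<∣p∣ u∈A)) w v)

  walk? : ∀ A u v → Dec (WalkIn Γ A u v)
  walk? A = walk?-acc (<-wellFounded ∣ A ∣)

data SimplePath (Γ : Graph) : Subset (n Γ) → Fin (n Γ) → Fin (n Γ) → Set where
  end  : ∀ {A u} → u ∈ A → SimplePath Γ A u u
  cons : ∀ {A u w v} → u ∈ A → adj Γ u w ≡ true → SimplePath Γ (A - u) w v → SimplePath Γ A u v

module _ {Γ : Graph} where

  pathLength : ∀ {A u v} → SimplePath Γ A u v → ℕ
  pathLength (end _)      = zero
  pathLength (cons _ _ p) = suc (pathLength p)

  vertexAt : ∀ {A u v} (p : SimplePath Γ A u v) → Fin (suc (pathLength p)) → Fin (n Γ)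
  vertexAt (end {u = u} _)      zero    = u
  vertexAt (cons {u = u} _ _ _) zero    = u
  vertexAt (cons _ _ p)         (suc i) = vertexAt p i

  vertexAt-∈ : ∀ {A u v} (p : SimplePath Γ A u v) i → vertexAt p i ∈ A
  vertexAt-∈ (end u∈A)      zero    = u∈A
  vertexAt-∈ (cons u∈A _ _) zero    = u∈A
  vertexAt-∈ (cons _ _ p)   (suc i) = p─q⊆p _ _ (vertexAt-∈ p i)

  vertexAt-first : ∀ {A u v} (p : SimplePath Γ A u v) → vertexAt p zero ≡ u
  vertexAt-first (end _)      = refl
  vertexAt-first (cons _ _ _) = refl

  vertexAt-last : ∀ {A u v} (p : SimplePath Γ A u v) → vertexAt p (fromℕ (pathLength p)) ≡ v
  vertexAt-last (end _)      = refl
  vertexAt-last (cons _ _ p) = vertexAt-last p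

  vertexAt-injective : ∀ {A u v} (p : SimplePath Γ A u v) → Injective _≡_ _≡_ (vertexAt p)
  vertexAt-injective (end _)      {zero}  {zero}  _ = refl
  vertexAt-injective (cons _ _ _) {zero}  {zero}  _ = refl
  vertexAt-injective (cons _ _ p) {zero}  {suc j} u≡pj  = ⊥-elim (x∈p-y⇒x≢y (vertexAt-∈ p j) (sym u≡pj))
  vertexAt-injective (cons _ _ p) {suc i} {zero}  pi≡u  = ⊥-elim (x∈p-y⇒x≢y (vertexAt-∈ p i) pi≡u)
  vertexAt-injective (cons _ _ p) {suc i} {suc j} pi≡pj = cong suc (vertexAt-injective p pi≡pj)

  vertexAt-adj : ∀ {A u v} (p : SimplePath Γ A u v) (i : Fin (pathLength p)) →
    adj Γ (vertexAt p (inject₁ i)) (vertexAt p (suc i)) ≡ true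
  vertexAt-adj (cons _ uw p) zero    = subst (λ w → adj Γ _ w ≡ true) (sym (vertexAt-first p)) uw
  vertexAt-adj (cons _ _ p)  (suc i) = vertexAt-adj p i

  toSimplePath-acc : ∀ {A u v} → Acc _<ℕ_ ∣ A ∣ → WalkIn Γ A u v → SimplePath Γ A u v
  toSimplePath-acc (acc smaller) p with walk-exit p
  ... | inj₁ refl              = end (walk-start p)
  ... | inj₂ (_ , uw , p-u) =
    cons (walk-start p) uw (toSimplePath-acc (smaller (x∈p⇒∣p-x∣<∣p∣ (walk-start p))) p-u)

  toSimplePath : ∀ {A u v} → WalkIn Γ A u v → SimplePath Γ A u v
  toSimplePath {A} = toSimplePath-acc (<-wellFounded ∣ A ∣)

  closed-simplePath-length≤1 : Acyclic Γ → ∀ {A u v} (p : SimplePath Γ A u v) → adj Γ v u ≡ true →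
    pathLength p ≤ℕ 1
  closed-simplePath-length≤1 _ (end _)               _  = z≤n
  closed-simplePath-length≤1 _ (cons _ _ (end _))    _  = s≤s z≤n
  closed-simplePath-length≤1 acyclic p@(cons _ _ (cons _ _ q)) vu =
    ⊥-elim (acyclic (pathLength q) (vertexAt p) (vertexAt-injective p , vertexAt-adj p , closing))
    where
    closing : adj Γ (vertexAt p (fromℕ (pathLength p))) (vertexAt p zero) ≡ true
    closing = subst (λ x → adj Γ x _ ≡ true) (sym (vertexAt-last p)) vu

  neighbours-disconnected : Acyclic Γ → ∀ {z y y′} → adj Γ z y ≡ true → adj Γ z y′ ≡ true →
    WalkIn Γ (⊤ - z) y y′ → y ≡ y′
  neighbours-disconnected acyclic {z} zy zy′ p with toSimplePath p
  ... | end _ = refl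
  ... | q@(cons _ _ _) with closed-simplePath-length≤1 acyclic (cons ∈⊤ zy q) (trans (adj-sym Γ _ z) zy′)
  ...   | s≤s ()

module Branches (Γ : Graph) (acyclic : Acyclic Γ) where

  reachableIn : Subset (n Γ) → Fin (n Γ) → Subset (n Γ)
  reachableIn A y = tabulate (λ x → does (walk? {Γ} A y x))

  x∈reachableIn⁺ : ∀ {A y x} → WalkIn Γ A y x → x ∈ reachableIn A y
  x∈reachableIn⁺ {A} {y} {x} p = x∈tabulate⁺ (dec-true (walk? A y x) p)

  x∈reachableIn⁻ : ∀ {A y x} → x ∈ reachableIn A y → WalkIn Γ A y x
  x∈reachableIn⁻ {A} {y} {x} x∈ = dec-true⁻ (walk? A y x) (x∈tabulate⁻ x∈)

  branch : Fin (n Γ) → Fin (n Γ) → Subset (n Γ)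
  branch z y = ⁅ z ⁆ ∪ reachableIn (⊤ - z) y

  z∈branch : ∀ {z} y → z ∈ branch z y
  z∈branch {z} _ = x∈p∪q⁺ (inj₁ (x∈⁅x⁆ z))

  x∈branch⁺ : ∀ {z y x} → WalkIn Γ (⊤ - z) y x → x ∈ branch z y
  x∈branch⁺ p = x∈p∪q⁺ (inj₂ (x∈reachableIn⁺ p))

  x∈branch⁻ : ∀ {z y x} → x ∈ branch z y → x ≡ z ⊎ WalkIn Γ (⊤ - z) y x
  x∈branch⁻ {z} x∈ = Sum.map (x∈⁅y⁆⇒x≡y z) x∈reachableIn⁻ (x∈p∪q⁻ _ _ x∈)

  y∈branch : ∀ {z y} → adj Γ z y ≡ true → y ∈ branch z y
  y∈branch zy = x∈branch⁺ (here (x≢y⇒x∈⊤-y (adj⇒≢ Γ zy ∘ sym)))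

  walk-from-z : ∀ {z y x} → adj Γ z y ≡ true → x ∈ branch z y → WalkIn Γ (branch z y) z x
  walk-from-z {y = y} zy x∈ with x∈branch⁻ x∈
  ... | inj₁ refl = here (z∈branch y)
  ... | inj₂ p    = step (z∈branch y) zy (walk-restrict x∈branch⁺ p)

  branch-connected : ∀ {z y} → adj Γ z y ≡ true → ConnectedIn Γ (branch z y)
  branch-connected zy u v u∈ v∈ = walk-reverse (walk-from-z zy u∈) ++ʷ walk-from-z zy v∈

  branch-degree : ∀ {z y} → adj Γ z y ≡ true → degIn Γ (branch z y) z ≡ 1
  branch-degree {z} {y} zy = only-x∈p⇒∣p∣≡1 (x∈p∩q⁺ (x∈tabulate⁺ zy , y∈branch zy)) only-y
    where
    only-y : ∀ {x} → x ∈ tabulate (adj Γ z) ∩ branch z y → x ≡ y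
    only-y x∈ with x∈p∩q⁻ _ _ x∈
    ... | zx , x∈branch with x∈branch⁻ x∈branch
    ... | inj₁ refl = contradiction refl (adj⇒≢ Γ (x∈tabulate⁻ zx))
    ... | inj₂ p    = sym (neighbours-disconnected acyclic zy (x∈tabulate⁻ zx) p)

  branch-maximal : ∀ {z y} → adj Γ z y ≡ true →
    ∀ S → ZLeafSubtree Γ z S → branch z y ⊆ S → S ⊆ branch z y
  branch-maximal {z} {y} zy S ((_ , connected) , z∈S , degree≡1) branch⊆S {x} x∈S
    with walk-exit (connected z x z∈S x∈S)
  ... | inj₁ refl = z∈branch y
  ... | inj₂ (w , zw , p) with w ≟ y
  ...   | yes refl = x∈branch⁺ (walk-mono p-x⊆⊤-x p)
  ...   | no w≢y   = ⊥-elim (ℕ.<-irrefl refl (subst (2 ≤ℕ_) degree≡1 (x≢y⇒2≤∣p∣ w∈ y∈ w≢y)))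
    where
    w∈ = x∈p∩q⁺ (x∈tabulate⁺ zw , p─q⊆p _ _ (walk-start p))
    y∈ = x∈p∩q⁺ (x∈tabulate⁺ zy , branch⊆S (y∈branch zy))

  branch-isZSubtree : ∀ {z y} → adj Γ z y ≡ true → IsZSubtree Γ z (branch z y)
  branch-isZSubtree {y = y} zy =
    (((_ , z∈branch y) , branch-connected zy) , z∈branch y , branch-degree zy) , branch-maximal zy

  branch-injective : ∀ {z y y′} → adj Γ z y ≡ true → adj Γ z y′ ≡ true →
    branch z y ≡ branch z y′ → y ≡ y′
  branch-injective zy zy′ same with x∈branch⁻ (subst (_ ∈_) (sym same) (y∈branch zy′))
  ... | inj₁ y′≡z = contradiction (sym y′≡z) (adj⇒≢ Γ zy′)
  ... | inj₂ p    = neighbours-disconnected acyclic zy zy′ p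

  branch-shrinks : ∀ {z y y′} → adj Γ z y ≡ true → adj Γ y y′ ≡ true → y′ ≢ z →
    ∣ branch y y′ ∣ <ℕ ∣ branch z y ∣
  branch-shrinks {z} {y} {y′} zy yy′ y′≢z = p⊂q⇒∣p∣<∣q∣ (inner⊆outer , z , z∈branch y , z∉inner)
    where
    yz = trans (adj-sym Γ y z) zy
    y∈⊤-z = x≢y⇒x∈⊤-y (adj⇒≢ Γ zy ∘ sym)

    inner⊆outer : branch y y′ ⊆ branch z y
    inner⊆outer x∈ with x∈branch⁻ x∈
    ... | inj₁ refl = y∈branch zy
    ... | inj₂ p with walk-avoids-or-reaches z p
    ...   | inj₁ p-z = x∈branch⁺ (step y∈⊤-z yy′ (walk-mono p-x⊆⊤-x p-z))
    ...   | inj₂ p→z = contradiction (neighbours-disconnected acyclic yy′ yz p→z) y′≢z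

    z∉inner : z ∉ branch y y′
    z∉inner z∈ with x∈branch⁻ z∈
    ... | inj₁ z≡y = adj⇒≢ Γ zy z≡y
    ... | inj₂ p   = y′≢z (neighbours-disconnected acyclic yy′ yz p)

  neighbourOtherThan? : ∀ z e y → Dec (adj Γ z y ≡ true × y ≢ e)
  neighbourOtherThan? z e y = (adj Γ z y Bool.≟ true) ×-dec ¬? (y ≟ e)

  neighboursExcept : Fin (n Γ) → Fin (n Γ) → List (Fin (n Γ))
  neighboursExcept z e = filter (neighbourOtherThan? z e) (allFin (n Γ))

  ∈-neighboursExcept⁺ : ∀ {z e y} → adj Γ z y ≡ true → y ≢ e → y ∈ˡ neighboursExcept z e
  ∈-neighboursExcept⁺ {z} {e} {y} zy y≢e = ∈-filter⁺ (neighbourOtherThan? z e) (∈-allFin y) (zy , y≢e)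

  ∈-neighboursExcept⁻ : ∀ {z e y} → y ∈ˡ neighboursExcept z e → adj Γ z y ≡ true × y ≢ e
  ∈-neighboursExcept⁻ {z} {e} y∈ = proj₂ (∈-filter⁻ (neighbourOtherThan? z e) {xs = allFin (n Γ)} y∈)

  pieces : Fin (n Γ) → Fin (n Γ) → List (Subset (n Γ))
  pieces z e = map (branch z) (neighboursExcept z e)

  pieces-unique : ∀ z e → Unique (pieces z e)
  pieces-unique z e =
    Unique-map⁺-injectiveOn
      (λ y∈ y′∈ → branch-injective (proj₁ (∈-neighboursExcept⁻ y∈)) (proj₁ (∈-neighboursExcept⁻ y′∈)))
      (Unique.filter⁺ (neighbourOtherThan? z e) (Unique.allFin⁺ (n Γ)))

  pieces-zSubtrees : ∀ z e → All (IsZSubtree Γ z) (pieces z e)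
  pieces-zSubtrees z e = All.map⁺ (All.tabulate (branch-isZSubtree ∘ proj₁ ∘ ∈-neighboursExcept⁻))

module Search {G : Graph} (D : TreeDecomposition G) {k : ℕ} (normal : IsNormal D k) where

  open Branches (T D) (proj₂ (proj₂ (T-tree D)))

  weight : Fin (n (T D)) → Subset (n (T D)) → ℕ
  weight z S = ∣ G⟨ D , S ⟩ z ∣

  total : Fin (n (T D)) → Fin (n (T D)) → ℕ
  total z e = sum (map (weight z) (pieces z e))

  InSomePiece : Fin (n (T D)) → Fin (n (T D)) → Fin (n G) → Set
  InSomePiece z e v = ∃ λ y → y ∈ˡ neighboursExcept z e × v ∈ G⟨ D , branch z y ⟩ z

  covered⇒∣p∣≤total : ∀ {z e p} → (∀ {v} → v ∈ p → InSomePiece z e v) → ∣ p ∣ ≤ℕ total z e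
  covered⇒∣p∣≤total {z} {e} covered = ∣p∣≤sum-over-cover (λ S → G⟨ D , S ⟩ z) (pieces z e) λ v∈p →
    let y , y∈ , v∈G = covered v∈p in Any.map⁺ (lose y∈ v∈G)

  tree-walk : ∀ u v → WalkIn (T D) ⊤ u v
  tree-walk u v =
    walk-mono (λ _ → ∈⊤) (proj₁ (proj₂ (T-tree D)) u v (x∈tabulate⁺ refl) (x∈tabulate⁺ refl))

  ∣∁B∣≤total : ∀ z → ∣ ∁ (B D z) ∣ ≤ℕ total z z
  ∣∁B∣≤total z = covered⇒∣p∣≤total covered
    where
    covered : ∀ {v} → v ∈ ∁ (B D z) → InSomePiece z z v
    covered {v} v∈∁Bz with proj₁ (vertex-subtree D v)
    ... | x , x∈bagsOf-v = leave-z (walk-exit (tree-walk z x))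
      where
      v∈Bx = lookup⇒[]= v (B D x) (x∈tabulate⁻ x∈bagsOf-v)
      v∉Bz = x∈∁p⇒x∉p v∈∁Bz

      leave-z : z ≡ x ⊎ ExitWalk (T D) ⊤ z x → InSomePiece z z v
      leave-z (inj₁ refl)         = contradiction v∈Bx v∉Bz
      leave-z (inj₂ (y , zy , p)) =
        y , ∈-neighboursExcept⁺ zy (adj⇒≢ (T D) zy ∘ sym) , ∈-G⟨⟩⁺ D (x∈branch⁺ p) v∈Bx v∉Bz

  ∣B─B∣≡1 : ∀ {y z} → adj (T D) y z ≡ true → ∣ B D y ─ B D z ∣ ≡ 1
  ∣B─B∣≡1 {y} {z} yz = ℕ.+-cancelˡ-≡ k _ _ (begin
    k ℕ.+ ∣ B D y ─ B D z ∣                 ≡⟨ cong (ℕ._+ _) (sym (proj₂ normal y z yz)) ⟩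
    ∣ B D y ∩ B D z ∣ ℕ.+ ∣ B D y ─ B D z ∣ ≡⟨ sym (∣p∣≡∣p∩q∣+∣p─q∣ (B D y) (B D z)) ⟩
    ∣ B D y ∣                               ≡⟨ proj₁ normal y ⟩
    suc k                                   ≡⟨ ℕ.+-comm 1 k ⟩
    k ℕ.+ 1                                 ∎)
    where open ≡-Reasoning

  weight-branch≤1+total : ∀ {z y} → adj (T D) z y ≡ true → weight z (branch z y) ≤ℕ suc (total y z)
  weight-branch≤1+total {z} {y} zy = begin
    ∣ Gz ∣                            ≡⟨ ∣p∣≡∣p∩q∣+∣p─q∣ Gz (B D y) ⟩
    ∣ Gz ∩ B D y ∣ ℕ.+ ∣ Gz ─ B D y ∣ ≤⟨ ℕ.+-mono-≤ (p⊆q⇒∣p∣≤∣q∣ Gz∩By⊆By─Bz) (covered⇒∣p∣≤total covered) ⟩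
    ∣ B D y ─ B D z ∣ ℕ.+ total y z   ≡⟨ cong (ℕ._+ total y z) (∣B─B∣≡1 (trans (adj-sym (T D) y z) zy)) ⟩
    suc (total y z)                   ∎
    where
    open ℕ.≤-Reasoning
    Gz = G⟨ D , branch z y ⟩ z

    Gz∩By⊆By─Bz : Gz ∩ B D y ⊆ B D y ─ B D z
    Gz∩By⊆By─Bz v∈ = let v∈Gz , v∈By = x∈p∩q⁻ Gz (B D y) v∈ in
      x∈p∧x∉q⇒x∈p─q v∈By (proj₂ (∈-G⟨⟩⁻ D {branch z y} v∈Gz))

    covered : ∀ {v} → v ∈ Gz ─ B D y → InSomePiece y z v
    covered v∈ with ∈-G⟨⟩⁻ D (p─q⊆p Gz (B D y) v∈)
    ... | (x , x∈branch , v∈Bx) , v∉Bz with x∈branch⁻ {z} {y} x∈branch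
    ...   | inj₁ refl = contradiction v∈Bx v∉Bz
    ...   | inj₂ p with walk-exit p
    ...     | inj₁ refl = contradiction v∈Bx (x∈p─q⇒x∉q Gz (B D y) v∈)
    ...     | inj₂ (y′ , yy′ , q) =
      y′ , ∈-neighboursExcept⁺ yy′ (x∈p-y⇒x≢y (p─q⊆p _ _ (walk-start q))) ,
      ∈-G⟨⟩⁺ D (x∈branch⁺ (walk-mono p-x⊆⊤-x q)) v∈Bx (x∈p─q⇒x∉q Gz (B D y) v∈)

  module _ {α : ℚ} (1≤α : 1ℚ ≤ α) where

    Balanced : Fin (n (T D)) → List (Subset (n (T D))) → Set
    Balanced z 𝒞 = Unique 𝒞 × All (IsZSubtree (T D) z) 𝒞
      × α < toℚ (sum (map (λ T′ → ∣ G⟨ D , T′ ⟩ z ∣) 𝒞))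
      × toℚ (sum (map (λ T′ → ∣ G⟨ D , T′ ⟩ z ∣) 𝒞)) ≤ toℚ 2 * α

    BalancedChoice : Set
    BalancedChoice = ∃ λ z → Σ (List (Subset (n (T D)))) (Balanced z)

    select : ∀ z e → α < toℚ (total z e) →
      (∀ {y} → y ∈ˡ neighboursExcept z e → α + α < toℚ (weight z (branch z y)) → BalancedChoice) →
      BalancedChoice
    select z e α<total into-heavy =
      Sum.[ descend-into-heavy , choose-window ] (heavy-or-window (weight z) (pieces z e) 0≤α α<total)
      where
      0≤α = ≤-trans (toℚ-mono-≤ {0} {1} z≤n) 1≤α
      descend-into-heavy : Any (λ S → α + α < toℚ (weight z S)) (pieces z e) → BalancedChoice
      descend-into-heavy heavy = let _ , y∈ , heavy-y = find (Any.map⁻ heavy) in into-heavy y∈ heavy-y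
      choose-window : ∃ (λ 𝒞 → 𝒞 Sublist.⊆ pieces z e × InWindow α (sum (map (weight z) 𝒞))) →
        BalancedChoice
      choose-window (𝒞 , 𝒞⊆pieces , α<w , w≤α+α) =
        z , 𝒞 , Unique-resp-⊆ 𝒞⊆pieces (pieces-unique z e) , All-resp-⊆ 𝒞⊆pieces (pieces-zSubtrees z e) ,
        α<w , subst (_ ≤_) (sym (2*p≡p+p α)) w≤α+α

    descend : ∀ {z y} → adj (T D) z y ≡ true → Acc _<ℕ_ ∣ branch z y ∣ →
      α + α < toℚ (weight z (branch z y)) → BalancedChoice
    descend {z} {y} zy (acc smaller) heavy =
      select y z (p+p<1+n⇒p<n (total y z) 1≤α (<-≤-trans heavy (toℚ-mono-≤ (weight-branch≤1+total zy))))
        λ y′∈ → let yy′ , y′≢z = ∈-neighboursExcept⁻ y′∈ in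
          descend yy′ (smaller (branch-shrinks zy yy′ y′≢z))

    search : α + toℚ k + 1ℚ < toℚ (n G) → BalancedChoice
    -- Excluding z₀ itself excludes no neighbour of z₀.
    search α+k+1<n =
      select z₀ z₀ α<total λ y∈ → descend (proj₁ (∈-neighboursExcept⁻ y∈)) (<-wellFounded _)
      where
      z₀ = fromℕ< (proj₁ (T-tree D))

      α+k+1≡α+[1+k] : α + toℚ k + 1ℚ ≡ α + toℚ (suc k)
      α+k+1≡α+[1+k] =
        trans (+-assoc α (toℚ k) 1ℚ) (cong (_+_ α) (trans (+-comm (toℚ k) 1ℚ) (sym (toℚ-homo-+ 1 k))))

      ∣∁Bz₀∣≡n∸[1+k] : ∣ ∁ (B D z₀) ∣ ≡ n G ∸ suc k
      ∣∁Bz₀∣≡n∸[1+k] = trans (∣∁p∣≡n∸∣p∣ (B D z₀)) (cong (n G ∸_) (proj₁ normal z₀))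

      α<total : α < toℚ (total z₀ z₀)
      α<total = <-≤-trans (p+m<n⇒p<n∸m (suc k) (n G) (subst (_< toℚ (n G)) α+k+1≡α+[1+k] α+k+1<n))
                          (toℚ-mono-≤ (subst (_≤ℕ total z₀ z₀) ∣∁Bz₀∣≡n∸[1+k] (∣∁B∣≤total z₀)))

lemma4p2 : ∀ (k : ℕ) (α : ℚ) (G : Graph) → 1 ≤ℕ k → 1ℚ ≤ α
  → α + toℚ k + 1ℚ < toℚ (n G) → HasTreewidth G k
  → (D : TreeDecomposition G) → IsNormal D k
  → ∃ λ (z : Fin (n (T D))) → Σ (List (Subset (n (T D)))) λ 𝒞 →
      Unique 𝒞 × All (IsZSubtree (T D) z) 𝒞
      × α < toℚ (sum (map (λ T′ → ∣ G⟨ D , T′ ⟩ z ∣) 𝒞))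
      × toℚ (sum (map (λ T′ → ∣ G⟨ D , T′ ⟩ z ∣) 𝒞)) ≤ toℚ 2 * α
lemma4p2 k α G _ 1≤α α+k+1<n _ D normal = Search.search D normal 1≤α α+k+1<n
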